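{- Let $n$ be a positive integer and let $m$ be any number obtained from $n$ by one Choix de Bruxelles operation. Then $\frac{n}{10} < m < 10n$. Moreover, both bounds are asymptotically sharp: for every $\varepsilon > 0$ there exist a positive integer $n$ and a number $m$ obtained from $n$ by one Choix de Bruxelles operation with $m > (10-\varepsilon) n$, and there exist a positive integer $n'$ and a number $m'$ obtained from $n'$ by one Choix de Bruxelles operation with $m' < (\frac{1}{10}+\varepsilon) n'$.
   Context: The Choix de Bruxelles operation: given a positive integer $n$ with decimal expansion $d_1 d_2 \ldots d_k$, choose indices $1 \le p \le q \le k$ with $d_p \neq 0$, let $s$ be the number with decimal representation $d_p d_{p+1}\ldots d_q$, and replace this substring in situ by the decimal expansion of $2s$, or, if $s$ is even, by the decimal expansion of $s/2$. One may also leave $n$ unchanged (empty substring). For example, $16$ can become any of $16, 26, 13, 112, 8, 32$.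
   Formalization: In the sharpness clauses, ε ranges only over the positive rationals. -}

module Defs where

open import Data.Nat using (ℕ; zero; suc; _+_; _*_; _<_; _≤_; NonZero)
open import Data.Nat.Properties using ()
open import Data.List using (List; []; _∷_; _++_; foldl)
open import Data.List.Relation.Unary.All using (All)
open import Data.Product using (Σ; _×_; _,_; ∃-syntax)
open import Data.Sum using (_⊎_)
open import Relation.Binary.PropositionalEquality using (_≡_)
open import Relation.Nullary using (¬_)

value : List ℕ → ℕ
value = foldl (λ acc d → acc * 10 + d) 0

data LeadingNonzero : List ℕ → Set where
  lead : ∀ d ds → ¬ d ≡ 0 → LeadingNonzero (d ∷ ds)

IsDigits : List ℕ → Set
IsDigits ds = All (λ d → d < 10) ds

-- ds is THE decimal expansion of the positive integer x
-- (digits < 10, no leading zero, nonempty; this determines ds uniquely)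
DecExp : ℕ → List ℕ → Set
DecExp x ds = IsDigits ds × LeadingNonzero ds × value ds ≡ x

Replacement : ℕ → ℕ → Set
Replacement s t = (t ≡ 2 * s) ⊎ (s ≡ 2 * t)

-- m is obtained from n by one Choix de Bruxelles operation:
-- either m = n (empty substring), or the decimal expansion of n splits as
-- A ++ S ++ B with S nonempty with nonzero first digit (S = d_p … d_q),
-- s = value S, and m is the number written A ++ (expansion of 2s or s/2) ++ B.
data Bruxelles (n : ℕ) : ℕ → Set where
  unchanged : Bruxelles n n
  step : ∀ (A S B T : List ℕ) (t : ℕ) →
         DecExp n (A ++ S ++ B) →
         LeadingNonzero S →
         Replacement (value S) t →
         DecExp t T →
         Bruxelles n (value (A ++ T ++ B))

-- Write n = (a·10^|S| + s)·10^|B| + v, where S is the replaced block of value s.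
-- Doubling s changes the length of its expansion by 0 or 1 digits, so the block
-- weight 10^|S| grows by a factor 1 or 10 while s itself grows by 2 < 10; hence
-- the result lies strictly between n and 10n.  Halving is doubling read backwards.
-- For sharpness, 1 0…0 5 ↦ 1 0…0 10 multiplies by 10 up to the additive constant 40.
module Submission where

open import Defs
open import Data.Nat using (ℕ; zero; suc; _+_; _*_; _<_; _>_; _≤_; _^_; z≤n; s≤s; z<s; s<s; _<?_; NonZero; >-nonZero)
open import Data.Nat.Properties
open import Data.Nat.Tactic.RingSolver using (solve-∀)
open import Data.Product using (_×_; ∃-syntax; _,_; proj₁; swap)
open import Data.Sum using (inj₁; inj₂)
open import Data.List using (List; []; _∷_; _++_; foldl; length; replicate)
open import Data.List.Properties using (foldl-++; length-++; length-replicate)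
open import Data.List.Relation.Unary.All using ([]; _∷_; all?)
open import Data.List.Relation.Unary.All.Properties using (++⁺; ++⁻ˡ; ++⁻ʳ; replicate⁺)
open import Relation.Binary.PropositionalEquality
open import Relation.Nullary using (yes; no; ¬_; contradiction)
open import Relation.Nullary.Decidable using (from-yes)

^-cancelʳ-< : ∀ m .{{_ : NonZero m}} {i j} → m ^ i < m ^ j → i < j
^-cancelʳ-< m {i} {j} mⁱ<mʲ with i <? j
... | yes i<j = i<j
... | no i≮j = contradiction (^-monoʳ-≤ m (≮⇒≥ i≮j)) (<⇒≱ mⁱ<mʲ)

n<10*n : ∀ {n} → n > 0 → n < 10 * n
n<10*n {suc n} _ = m<m+n (suc n) z<s

n<10^n : ∀ n → n < 10 ^ n
n<10^n zero = z<s
n<10^n (suc n) = <-≤-trans (s<s (n<10^n n)) (^-monoʳ-< 10 (s≤s (s≤s z≤n)) (n<1+n n))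

shift-in : ℕ → ℕ → ℕ
shift-in acc d = acc * 10 + d

foldl-shift-in : ∀ acc ds → foldl shift-in acc ds ≡ acc * 10 ^ length ds + value ds
foldl-shift-in acc [] = sym (trans (+-identityʳ (acc * 1)) (*-identityʳ acc))
foldl-shift-in acc (d ∷ ds) = begin
    foldl shift-in (acc * 10 + d) ds           ≡⟨ foldl-shift-in (acc * 10 + d) ds ⟩
    (acc * 10 + d) * 10 ^ length ds + value ds ≡⟨ regroup acc d (10 ^ length ds) (value ds) ⟩
    acc * (10 * 10 ^ length ds) + (d * 10 ^ length ds + value ds)
      ≡⟨ cong (acc * (10 * 10 ^ length ds) +_) (sym (foldl-shift-in d ds)) ⟩
    acc * 10 ^ length (d ∷ ds) + value (d ∷ ds) ∎
  where
  open ≡-Reasoning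
  regroup : ∀ a d p v → (a * 10 + d) * p + v ≡ a * (10 * p) + (d * p + v)
  regroup = solve-∀

value-∷ : ∀ d ds → value (d ∷ ds) ≡ d * 10 ^ length ds + value ds
value-∷ = foldl-shift-in

value-++ : ∀ xs ys → value (xs ++ ys) ≡ value xs * 10 ^ length ys + value ys
value-++ xs ys = trans (foldl-++ shift-in 0 xs ys) (foldl-shift-in (value xs) ys)

value<10^length : ∀ {ds} → IsDigits ds → value ds < 10 ^ length ds
value<10^length {[]} [] = z<s
value<10^length {d ∷ ds} (d<10 ∷ digits) = begin-strict
    value (d ∷ ds)     ≡⟨ value-∷ d ds ⟩
    d * p + value ds   <⟨ +-monoʳ-< (d * p) (value<10^length digits) ⟩
    d * p + p          ≡⟨ +-comm (d * p) p ⟩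
    suc d * p          ≤⟨ *-monoˡ-≤ p d<10 ⟩
    10 * p             ∎
  where
  open ≤-Reasoning
  p : ℕ
  p = 10 ^ length ds

10^length≤value-∷ : ∀ d ds → ¬ d ≡ 0 → 10 ^ length ds ≤ value (d ∷ ds)
10^length≤value-∷ zero ds d≢0 = contradiction refl d≢0
10^length≤value-∷ (suc d) ds _ = begin
    p                     ≤⟨ m≤m+n p (d * p) ⟩
    suc d * p             ≤⟨ m≤m+n (suc d * p) (value ds) ⟩
    suc d * p + value ds  ≡⟨ sym (value-∷ (suc d) ds) ⟩
    value (suc d ∷ ds)    ∎
  where
  open ≤-Reasoning
  p : ℕ
  p = 10 ^ length ds

leadingNonzero-++ : ∀ {ds} es → LeadingNonzero ds → LeadingNonzero (ds ++ es)
leadingNonzero-++ es (lead d ds d≢0) = lead d (ds ++ es) d≢0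

decExp-positive : ∀ {x ds} → DecExp x ds → x > 0
decExp-positive (_ , lead d ds d≢0 , refl) =
  <-≤-trans (m^n>0 10 (length ds)) (10^length≤value-∷ d ds d≢0)

decExp-length-≤ : ∀ {x y ds es} j → DecExp x ds → DecExp y es →
                  x ≤ 10 ^ j * y → length ds ≤ j + length es
decExp-length-≤ {es = es} j (_ , lead d ds d≢0 , refl) (digits , _ , refl) x≤ =
  ^-cancelʳ-< 10 (begin-strict
    10 ^ length ds           ≤⟨ 10^length≤value-∷ d ds d≢0 ⟩
    value (d ∷ ds)           ≤⟨ x≤ ⟩
    10 ^ j * value es        <⟨ *-monoʳ-< (10 ^ j) {{m^n≢0 10 j}} (value<10^length digits) ⟩
    10 ^ j * 10 ^ length es  ≡⟨ sym (^-distribˡ-+-* 10 j (length es)) ⟩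
    10 ^ (j + length es)     ∎)
  where open ≤-Reasoning

value-splice : ∀ A S B →
  value (A ++ S ++ B) ≡ (value A * 10 ^ length S + value S) * 10 ^ length B + value B
value-splice A S B = begin
    value (A ++ S ++ B)
      ≡⟨ value-++ A (S ++ B) ⟩
    value A * 10 ^ length (S ++ B) + value (S ++ B)
      ≡⟨ cong₂ (λ l w → value A * 10 ^ l + w) (length-++ S) (value-++ S B) ⟩
    value A * 10 ^ (length S + length B) + (value S * r + value B)
      ≡⟨ cong (λ q → value A * q + (value S * r + value B)) (^-distribˡ-+-* 10 (length S) (length B)) ⟩
    value A * (10 ^ length S * r) + (value S * r + value B)
      ≡⟨ regroup (value A) (10 ^ length S) r (value S) (value B) ⟩
    (value A * 10 ^ length S + value S) * r + value B ∎
  where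
  open ≡-Reasoning
  r : ℕ
  r = 10 ^ length B
  regroup : ∀ a p r s v → a * (p * r) + (s * r + v) ≡ (a * p + s) * r + v
  regroup = solve-∀

splice-mono-< : ∀ A B {S T} → length S ≤ length T → value S < value T →
                value (A ++ S ++ B) < value (A ++ T ++ B)
splice-mono-< A B {S} {T} |S|≤|T| s<t
  rewrite value-splice A S B | value-splice A T B =
  +-monoˡ-< (value B) (*-monoˡ-< (10 ^ length B) {{m^n≢0 10 (length B)}}
    (+-mono-≤-< (*-monoʳ-≤ (value A) (^-monoʳ-≤ 10 |S|≤|T|)) s<t))

splice-<-10* : ∀ A B {S T} → length T ≤ suc (length S) → value T < 10 * value S →
               value (A ++ T ++ B) < 10 * value (A ++ S ++ B)
splice-<-10* A B {S} {T} |T|≤1+|S| t<10s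
  rewrite value-splice A S B | value-splice A T B = begin-strict
    (a * Q + t) * R + v              <⟨ +-mono-<-≤ (*-monoˡ-< R {{m^n≢0 10 (length B)}} block<) (m≤n*m v 10) ⟩
    (10 * (a * P + s)) * R + 10 * v  ≡⟨ regroup a P s R v ⟩
    10 * ((a * P + s) * R + v)       ∎
  where
  open ≤-Reasoning
  a s t v P Q R : ℕ
  a = value A
  s = value S
  t = value T
  v = value B
  P = 10 ^ length S
  Q = 10 ^ length T
  R = 10 ^ length B
  factor-10 : ∀ a P s → a * (10 * P) + 10 * s ≡ 10 * (a * P + s)
  factor-10 = solve-∀
  block< : a * Q + t < 10 * (a * P + s)
  block< = begin-strict
    a * Q + t              <⟨ +-mono-≤-< (*-monoʳ-≤ a (^-monoʳ-≤ 10 |T|≤1+|S|)) t<10s ⟩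
    a * (10 * P) + 10 * s  ≡⟨ factor-10 a P s ⟩
    10 * (a * P + s)       ∎
  regroup : ∀ a P s R v → (10 * (a * P + s)) * R + 10 * v ≡ 10 * ((a * P + s) * R + v)
  regroup = solve-∀

splice-doubling : ∀ A B {s S T} → DecExp s S → DecExp (2 * s) T →
                  value (A ++ S ++ B) < value (A ++ T ++ B)
                  × value (A ++ T ++ B) < 10 * value (A ++ S ++ B)
splice-doubling A B {s} {S} {T} expS@(_ , _ , refl) expT@(_ , _ , t≡2s) =
    splice-mono-< A B |S|≤|T| (subst (s <_) (sym t≡2s) s<2s)
  , splice-<-10* A B |T|≤1+|S| (subst (_< 10 * s) (sym t≡2s) 2s<10s)
  where
  instance
    s≢0 : NonZero s
    s≢0 = >-nonZero (decExp-positive expS)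
  s<2s : s < 2 * s
  s<2s = subst (_< 2 * s) (*-identityˡ s) (*-monoˡ-< s {1} {2} (s≤s (s≤s z≤n)))
  2s<10s : 2 * s < 10 * s
  2s<10s = *-monoˡ-< s {2} {10} (s≤s (s≤s (s≤s z≤n)))
  |S|≤|T| : length S ≤ length T
  |S|≤|T| = decExp-length-≤ 0 expS expT (subst (s ≤_) (sym (*-identityˡ (2 * s))) (<⇒≤ s<2s))
  |T|≤1+|S| : length T ≤ suc (length S)
  |T|≤1+|S| = decExp-length-≤ 1 expT expS (<⇒≤ 2s<10s)

within-factor-10 : ∀ {x y} → x < y × y < 10 * x → x < 10 * y × y < 10 * x
within-factor-10 {y = y} (x<y , y<10x) = <-≤-trans x<y (m≤n*m y 10) , y<10x

bruxelles-within-factor-10 : ∀ {n m} → n > 0 → Bruxelles n m → n < 10 * m × m < 10 * n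
bruxelles-within-factor-10 n>0 unchanged = n<10*n n>0 , n<10*n n>0
bruxelles-within-factor-10 _ (step A S B T t (digits , _ , refl) leadS replacement expT) =
  from-replacement replacement
  where
  expS : DecExp (value S) S
  expS = ++⁻ˡ S (++⁻ʳ A digits) , leadS , refl
  from-replacement : Replacement (value S) t →
    value (A ++ S ++ B) < 10 * value (A ++ T ++ B) × value (A ++ T ++ B) < 10 * value (A ++ S ++ B)
  from-replacement (inj₁ t≡2s) =
    within-factor-10 (splice-doubling A B expS (subst (λ x → DecExp x T) t≡2s expT))
  from-replacement (inj₂ s≡2t) =
    swap (within-factor-10 (splice-doubling A B expT (subst (λ x → DecExp x S) s≡2t expS)))

digits-5 : IsDigits (5 ∷ [])
digits-5 = from-yes (all? (_<? 10) (5 ∷ []))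

digits-10 : IsDigits (1 ∷ 0 ∷ [])
digits-10 = from-yes (all? (_<? 10) (1 ∷ 0 ∷ []))

five-to-ten : ∀ {A} → IsDigits A → LeadingNonzero A →
              Bruxelles (value (A ++ 5 ∷ [])) (value (A ++ 1 ∷ 0 ∷ []))
five-to-ten {A} digits leadA =
  step A (5 ∷ []) [] (1 ∷ 0 ∷ []) 10
    (++⁺ digits digits-5 , leadingNonzero-++ _ leadA , refl)
    (lead 5 [] (λ ())) (inj₁ refl) (digits-10 , lead 1 _ (λ ()) , refl)

ten-to-five : ∀ {A} → IsDigits A → LeadingNonzero A →
              Bruxelles (value (A ++ 1 ∷ 0 ∷ [])) (value (A ++ 5 ∷ []))
ten-to-five {A} digits leadA =
  step A (1 ∷ 0 ∷ []) [] (5 ∷ []) 5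
    (++⁺ digits digits-10 , leadingNonzero-++ _ leadA , refl)
    (lead 1 _ (λ ())) (inj₂ refl) (digits-5 , lead 5 [] (λ ()) , refl)

10*value-++-5 : ∀ A → 10 * value (A ++ 5 ∷ []) ≡ value (A ++ 1 ∷ 0 ∷ []) + 40
10*value-++-5 A = begin
    10 * value (A ++ 5 ∷ [])      ≡⟨ cong (10 *_) (value-++ A (5 ∷ [])) ⟩
    10 * (value A * 10 + 5)       ≡⟨ expand (value A) ⟩
    value A * 100 + 10 + 40       ≡⟨ cong (_+ 40) (sym (value-++ A (1 ∷ 0 ∷ []))) ⟩
    value (A ++ 1 ∷ 0 ∷ []) + 40  ∎
  where
  open ≡-Reasoning
  expand : ∀ a → 10 * (a * 10 + 5) ≡ a * 100 + 10 + 40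
  expand = solve-∀

40*b<a*value-++-5 : ∀ {a} b A .{{_ : NonZero a}} → 4 * b < value A → 40 * b < a * value (A ++ 5 ∷ [])
40*b<a*value-++-5 {a} b A 4b<A = begin-strict
    40 * b                    ≡⟨ *-assoc 10 4 b ⟩
    10 * (4 * b)              <⟨ *-monoʳ-< 10 4b<A ⟩
    10 * value A              ≡⟨ *-comm 10 (value A) ⟩
    value A * 10              ≤⟨ m≤m+n (value A * 10) 5 ⟩
    value A * 10 + 5          ≡⟨ sym (value-++ A (5 ∷ [])) ⟩
    value (A ++ 5 ∷ [])       ≤⟨ m≤n*m (value (A ++ 5 ∷ [])) a ⟩
    a * value (A ++ 5 ∷ [])   ∎
  where open ≤-Reasoning

almost-tenfold : ∀ a b {n m} → 10 * n ≡ m + 40 → 40 * b < a * n → 10 * b * n < b * m + a * n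
almost-tenfold a b {n} {m} 10n≡m+40 40b<an = begin-strict
    10 * b * n      ≡⟨ move-10 b n ⟩
    b * (10 * n)    ≡⟨ cong (b *_) 10n≡m+40 ⟩
    b * (m + 40)    ≡⟨ distrib b m ⟩
    b * m + 40 * b  <⟨ +-monoʳ-< (b * m) 40b<an ⟩
    b * m + a * n   ∎
  where
  open ≤-Reasoning
  move-10 : ∀ b n → 10 * b * n ≡ b * (10 * n)
  move-10 = solve-∀
  distrib : ∀ b m → b * (m + 40) ≡ b * m + 40 * b
  distrib = solve-∀

almost-tenth : ∀ a b {n m} → 10 * n ≡ m + 40 → 40 * b < a * n → n < 10 * m →
               10 * b * n < b * m + 10 * a * m
almost-tenth a b {n} {m} 10n≡m+40 40b<an n<10m = begin-strict
    10 * b * n            <⟨ almost-tenfold a b 10n≡m+40 40b<an ⟩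
    b * m + a * n         ≤⟨ +-monoʳ-≤ (b * m) (*-monoʳ-≤ a (<⇒≤ n<10m)) ⟩
    b * m + a * (10 * m)  ≡⟨ cong (b * m +_) (move-10 a m) ⟩
    b * m + 10 * a * m    ∎
  where
  open ≤-Reasoning
  move-10 : ∀ a m → a * (10 * m) ≡ 10 * a * m
  move-10 = solve-∀

1-then-zeros : ℕ → List ℕ
1-then-zeros k = 1 ∷ replicate k 0

1-then-zeros-digits : ∀ k → IsDigits (1-then-zeros k)
1-then-zeros-digits k = s≤s (s≤s z≤n) ∷ replicate⁺ k z<s

1-then-zeros-lead : ∀ k → LeadingNonzero (1-then-zeros k)
1-then-zeros-lead k = lead 1 (replicate k 0) (λ ())

k<value-1-then-zeros : ∀ k → k < value (1-then-zeros k)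
k<value-1-then-zeros k = begin-strict
    k                               <⟨ n<10^n k ⟩
    10 ^ k                          ≡⟨ cong (10 ^_) (sym (length-replicate k)) ⟩
    10 ^ length (replicate k 0)     ≤⟨ 10^length≤value-∷ 1 (replicate k 0) (λ ()) ⟩
    value (1-then-zeros k)          ∎
  where open ≤-Reasoning

-- ε = a / b; the witnesses do not need b > 0.
bruxelles-ratios-near-10 : ∀ a b → a > 0 →
    (∃[ n ] ∃[ m ] (n > 0 × Bruxelles n m × (10 * b * n < b * m + a * n)))
    × (∃[ n' ] ∃[ m' ] (n' > 0 × Bruxelles n' m' × (10 * b * m' < b * n' + 10 * a * n')))
bruxelles-ratios-near-10 a b a>0 =
    (n , m , n>0 , five-to-ten digitsA leadA , almost-tenfold a b 10n≡m+40 40b<an)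
  , (m , n , m>0 , ten-to-five digitsA leadA , almost-tenth a b 10n≡m+40 40b<an n<10m)
  where
  instance
    a≢0 : NonZero a
    a≢0 = >-nonZero a>0
  A : List ℕ
  A = 1-then-zeros (4 * b)
  digitsA : IsDigits A
  digitsA = 1-then-zeros-digits (4 * b)
  leadA : LeadingNonzero A
  leadA = 1-then-zeros-lead (4 * b)
  n m : ℕ
  n = value (A ++ 5 ∷ [])
  m = value (A ++ 1 ∷ 0 ∷ [])
  n>0 : n > 0
  n>0 = decExp-positive (++⁺ digitsA digits-5 , leadingNonzero-++ _ leadA , refl)
  m>0 : m > 0
  m>0 = decExp-positive (++⁺ digitsA digits-10 , leadingNonzero-++ _ leadA , refl)
  10n≡m+40 : 10 * n ≡ m + 40
  10n≡m+40 = 10*value-++-5 A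
  40b<an : 40 * b < a * n
  40b<an = 40*b<a*value-++-5 b A (k<value-1-then-zeros (4 * b))
  n<10m : n < 10 * m
  n<10m = proj₁ (bruxelles-within-factor-10 n>0 (five-to-ten digitsA leadA))

theorem3 : ((n m : ℕ) → n > 0 → Bruxelles n m → (n < 10 * m) × (m < 10 * n))
    × ((a b : ℕ) → a > 0 → b > 0 →
        (∃[ n ] ∃[ m ] (n > 0 × Bruxelles n m × (10 * b * n < b * m + a * n)))
        × (∃[ n' ] ∃[ m' ] (n' > 0 × Bruxelles n' m' × (10 * b * m' < b * n' + 10 * a * n'))))
theorem3 = (λ _ _ → bruxelles-within-factor-10) , λ a b a>0 _ → bruxelles-ratios-near-10 a b a>0
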